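{- Let $G$ be a tournament with $t$ vertices and let $s=\lfloor \sqrt{2t}\rfloor+1$. Then there is a linear ordering $\pi$ of $V(G)$ such that $R_\pi(G)$ contains no transitive subtournament of order $s$, i.e. there is no set of $s$ vertices that are pairwise adjacent in $R_\pi(G)$.
   Context: A tournament is an orientation of a complete graph. For a tournament $G$ and a linear ordering $\pi$ of $V(G)$, $R_\pi(G)$ is the spanning subgraph of $G$ whose edges are exactly the edges $(i,j)$ of $G$ (directed from $i$ to $j$) such that $i$ appears before $j$ in $\pi$. A transitive subtournament of order $s$ is a set of $s$ vertices inducing a tournament with no directed cycle. -}

module Defs where

open import Data.Nat using (ℕ; zero; suc; _*_; _<_; _≤ᵇ_)
open import Data.Bool using (if_then_else_)
open import Data.Fin using (Fin; toℕ)
open import Data.Product using (_×_; Σ)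
open import Data.Sum using (_⊎_)
open import Function.Bundles using (_↔_; Inverse)
open import Function.Definitions using (Injective)
open import Relation.Binary.PropositionalEquality using (_≡_; _≢_)
open import Relation.Nullary using (¬_)

⌊√_⌋ : ℕ → ℕ
⌊√ zero ⌋ = zero
⌊√ suc n ⌋ with ⌊√ n ⌋
... | r = if suc r * suc r ≤ᵇ suc n then suc r else r

-- Every pair of distinct vertices is joined by exactly one directed edge
-- (antisymmetry also forces irreflexivity: no loops).
record IsTournament {t : ℕ} (E : Fin t → Fin t → Set) : Set where
  field
    total      : ∀ i j → i ≢ j → E i j ⊎ E j i
    asymmetric : ∀ i j → E i j → ¬ E j i

-- A linear ordering π of V(G) = Fin t: π is a bijection Fin t ↔ Fin t,
-- where Inverse.to π k is the vertex at position k; vertex i appears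
-- before j iff its position Inverse.from π i is smaller.
LinearOrdering : ℕ → Set
LinearOrdering t = Fin t ↔ Fin t

Before : ∀ {t} → Fin t → Fin t → LinearOrdering t → Set
Before i j π = toℕ (Inverse.from π i) < toℕ (Inverse.from π j)

R : ∀ {t} → (Fin t → Fin t → Set) → LinearOrdering t → Fin t → Fin t → Set
R E π i j = E i j × (Before i j π)

Adjacent : ∀ {t} → (Fin t → Fin t → Set) → Fin t → Fin t → Set
Adjacent D i j = D i j ⊎ D j i

PairwiseAdjacentSet : ∀ {t} (s : ℕ) → (Fin t → Fin t → Set) → Set
PairwiseAdjacentSet {t} s D =
  Σ (Fin s → Fin t) λ f → Injective _≡_ _≡_ f ×
    (∀ a b → a ≢ b → Adjacent D (f a) (f b))

-- Order the vertices as a list; a chain is a sublist along which every edge of G points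
-- forward, i.e. a transitive subtournament of R_π for the ordering π that the list spells out.
-- To order a vertex set S so that chains have at most k vertices, given 2|S| < (k+1)²: if S
-- has a transitive subtournament X on k+1 vertices, list X backwards first, so that every
-- chain meets it at most once, and then the rest of S ordered with chains of at most k-1
-- vertices, which is possible because 2(|S|-k-1) < k². Otherwise any order of S will do.
-- For S = V(G) take k = ⌊√(2t)⌋.
module Submission where

open import Level using (Level)
open import Data.Nat using (ℕ; zero; suc; _+_; _*_; _≤_; _<_; z≤n; s≤s; z<s; _≤ᵇ_)
open import Data.Nat.Properties
  using (≤-trans; +-mono-≤; <-irrefl; <-asym; 1+n≰n; n<1+n; *-mono-<; ≤⇒≤ᵇ; ≰⇒>; +-cancelʳ-<; module ≤-Reasoning)
open import Data.Nat.Solver using (module +-*-Solver)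
open import Data.Bool using (true; false; T)
open import Data.Fin using (Fin; zero; suc; toℕ; _≟_)
open import Data.Fin.Properties using (any?; injective⇒≤)
open import Data.List using (List; []; _∷_; _++_; [_]; length; lookup; filter; reverse; allFin)
open import Data.List.Properties using (length-++; length-tabulate; filter-all; tabulate-lookup; unfold-reverse)
open import Data.List.Relation.Unary.All as All using (All; []; _∷_)
open import Data.List.Relation.Unary.All.Properties using (all-filter)
open import Data.List.Relation.Unary.Any using (here; there; index)
open import Data.List.Relation.Unary.Any.Properties using (lookup-index)
open import Data.List.Relation.Unary.AllPairs as AllPairs using (AllPairs; []; _∷_)
import Data.List.Relation.Unary.AllPairs.Properties as AllPairs
open import Data.List.Relation.Unary.Unique.Propositional using (Unique)
open import Data.List.Relation.Unary.Unique.Propositional.Properties using (allFin⁺)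
open import Data.List.Membership.Propositional using (_∈_)
open import Data.List.Membership.Propositional.Properties using (∈-lookup; ∈-allFin; ∈-filter⁺)
open import Data.List.Membership.Setoid.Properties using (index-injective)
open import Data.List.Relation.Binary.Sublist.Propositional using (_⊆_; []; _∷_; _∷ʳ_; minimum; ⊆-refl; ⊆-trans)
open import Data.List.Relation.Binary.Sublist.Propositional.Properties
  using (All-resp-⊆; filter-⊆; ++⁺ˡ; ++⁺ʳ)
import Data.List.Relation.Binary.Sublist.Propositional.Properties as Sublist
open import Data.List.Relation.Binary.Permutation.Propositional using (_↭_; ↭-refl; ↭-sym; ↭-trans; prep; ↭⇒↭ₛ)
open import Data.List.Relation.Binary.Permutation.Propositional.Properties using (↭-length; ∈-resp-↭; All-resp-↭; shift; ++⁺; ↭-reverse)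
open import Data.List.Relation.Binary.Permutation.Setoid.Properties using (Unique-resp-↭)
open import Data.Product using (Σ; ∃; _×_; _,_)
open import Data.Sum using (_⊎_; inj₁; inj₂)
open import Data.Empty using (⊥-elim)
open import Relation.Nullary using (¬_; Dec; yes; no)
open import Relation.Unary using (Pred)
open import Relation.Binary using (Rel; Decidable; Asymmetric)
open import Relation.Binary.PropositionalEquality using (_≡_; refl; sym; trans; cong; subst; subst₂; setoid)
open import Function using (flip; _∘_; id)
open import Function.Bundles using (_↔_; Inverse; mk↔ₛ′)
open import Function.Definitions using (Injective)

open import Defs

private
  variable
    a ℓ p : Level
    A : Set a

n<[1+⌊√n⌋]² : ∀ n → n < suc ⌊√ n ⌋ * suc ⌊√ n ⌋
n<[1+⌊√n⌋]² zero = z<s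
n<[1+⌊√n⌋]² (suc n) with ⌊√ n ⌋ | n<[1+⌊√n⌋]² n
... | r | n<[1+r]² with suc r * suc r ≤ᵇ suc n in step
... | true  = ≤-trans (s≤s n<[1+r]²) (*-mono-< (n<1+n (suc r)) (n<1+n (suc r)))
... | false = ≰⇒> (λ [1+r]²≤1+n → subst T step (≤⇒≤ᵇ [1+r]²≤1+n))

2*[2+r+c]<[2+r]²⇒2*c<[1+r]² : ∀ r c →
  2 * (2 + r + c) < (2 + r) * (2 + r) → 2 * c < (1 + r) * (1 + r)
2*[2+r+c]<[2+r]²⇒2*c<[1+r]² r c hyp =
  +-cancelʳ-< (2 * r + 3) (2 * c) ((1 + r) * (1 + r)) (begin-strict
    2 * c + (2 * r + 3)              <⟨ n<1+n _ ⟩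
    suc (2 * c + (2 * r + 3))        ≡⟨ left r c ⟩
    2 * (2 + r + c)                  <⟨ hyp ⟩
    (2 + r) * (2 + r)                ≡⟨ right r ⟩
    (1 + r) * (1 + r) + (2 * r + 3)  ∎)
  where
  open ≤-Reasoning
  open +-*-Solver
  left : ∀ r c → suc (2 * c + (2 * r + 3)) ≡ 2 * (2 + r + c)
  left = solve 2 (λ r c → con 1 :+ (con 2 :* c :+ (con 2 :* r :+ con 3))
                        := con 2 :* (con 2 :+ r :+ c)) refl
  right : ∀ r → (2 + r) * (2 + r) ≡ (1 + r) * (1 + r) + (2 * r + 3)
  right = solve 1 (λ r → (con 2 :+ r) :* (con 2 :+ r)
                       := (con 1 :+ r) :* (con 1 :+ r) :+ (con 2 :* r :+ con 3)) refl

module _ {R : Rel A ℓ} where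

  AllPairs-resp-⊆ : ∀ {xs ys} → xs ⊆ ys → AllPairs R ys → AllPairs R xs
  AllPairs-resp-⊆ []          []         = []
  AllPairs-resp-⊆ (y ∷ʳ xs⊆)  (_ ∷ Rys)  = AllPairs-resp-⊆ xs⊆ Rys
  AllPairs-resp-⊆ (refl ∷ xs⊆) (Ry ∷ Rys) = All-resp-⊆ xs⊆ Ry ∷ AllPairs-resp-⊆ xs⊆ Rys

  AllPairs-reverse : ∀ {xs} → AllPairs R xs → AllPairs (flip R) (reverse xs)
  AllPairs-reverse {[]}     []          = []
  AllPairs-reverse {x ∷ xs} (Rx ∷ Rxs) rewrite unfold-reverse x xs =
    AllPairs.++⁺ (AllPairs-reverse Rxs) ([] ∷ [])
                 (All-resp-↭ (↭-sym (↭-reverse xs)) (All.map (_∷ []) Rx))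

All⇒AllPairs : {P : Pred A p} → ∀ {xs} → All P xs → AllPairs (λ x y → P x × P y) xs
All⇒AllPairs []         = []
All⇒AllPairs (px ∷ pxs) = All.map (px ,_) pxs ∷ All⇒AllPairs pxs

⊆-++-split : ∀ {xs} ys zs → xs ⊆ ys ++ zs →
  Σ (List A) λ xs₁ → Σ (List A) λ xs₂ → xs ≡ xs₁ ++ xs₂ × xs₁ ⊆ ys × xs₂ ⊆ zs
⊆-++-split []       zs xs⊆          = [] , _ , refl , [] , xs⊆
⊆-++-split (y ∷ ys) zs (.y ∷ʳ xs⊆) with ⊆-++-split ys zs xs⊆
... | xs₁ , xs₂ , refl , xs₁⊆ , xs₂⊆ = xs₁ , xs₂ , refl , y ∷ʳ xs₁⊆ , xs₂⊆
⊆-++-split (y ∷ ys) zs (refl ∷ xs⊆) with ⊆-++-split ys zs xs⊆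
... | xs₁ , xs₂ , refl , xs₁⊆ , xs₂⊆ = y ∷ xs₁ , xs₂ , refl , refl ∷ xs₁⊆ , xs₂⊆

⊆-complement : ∀ {xs ys : List A} → xs ⊆ ys → Σ (List A) λ zs → ys ↭ xs ++ zs
⊆-complement [] = [] , ↭-refl
⊆-complement {xs = xs} (y ∷ʳ xs⊆) with ⊆-complement xs⊆
... | zs , ys↭ = y ∷ zs , ↭-trans (prep y ys↭) (↭-sym (shift y xs zs))
⊆-complement (refl ∷ xs⊆) with ⊆-complement xs⊆
... | zs , ys↭ = zs , prep _ ys↭

index-lookup : ∀ {xs : List A} → Unique xs → ∀ i (p : lookup xs i ∈ xs) → index p ≡ i
index-lookup _          zero    (here _)   = refl
index-lookup (x∉xs ∷ _) zero    (there p)  = ⊥-elim (All.lookup x∉xs p refl)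
index-lookup (x∉xs ∷ _) (suc i) (here eq)  = ⊥-elim (All.lookup x∉xs (∈-lookup i) (sym eq))
index-lookup (_ ∷ uniq) (suc i) (there p)  = cong suc (index-lookup uniq i p)

module _ {xs : List A} (unique : Unique xs) (complete : ∀ x → x ∈ xs) where

  enumeration : ∀ {n} → length xs ≡ n → Fin n ↔ A
  enumeration refl = mk↔ₛ′ (lookup xs) (index ∘ complete)
    (λ x → sym (lookup-index (complete x)))
    (λ i → index-lookup unique i (complete (lookup xs i)))

  enumeration-increasing : ∀ {n} (len : length xs ≡ n) →
    AllPairs (λ x y → toℕ (Inverse.from (enumeration len) x) < toℕ (Inverse.from (enumeration len) y)) xs
  enumeration-increasing refl = subst (AllPairs _) (tabulate-lookup xs)
    (AllPairs.tabulate⁺-< λ {i} {j} i<j →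
      subst₂ (λ i j → toℕ i < toℕ j)
             (sym (index-lookup unique i _)) (sym (index-lookup unique j _)) i<j)

ChainsAtMost : Rel A ℓ → ℕ → List A → Set _
ChainsAtMost E r L = ∀ {Y} → Y ⊆ L → AllPairs E Y → length Y ≤ r

Chain : Rel A ℓ → ℕ → List A → Set _
Chain {A = A} E k L = Σ (List A) λ Y → Y ⊆ L × AllPairs E Y × length Y ≡ k

module _ {E : Rel A ℓ} where

  chainsAtMost-++ : ∀ {r s L M} → ChainsAtMost E r L → ChainsAtMost E s M →
                    ChainsAtMost E (r + s) (L ++ M)
  chainsAtMost-++ {L = L} {M} bound-L bound-M Y⊆ chain
    with ⊆-++-split L M Y⊆
  ... | Y₁ , Y₂ , refl , Y₁⊆ , Y₂⊆ = begin
    length (Y₁ ++ Y₂)      ≡⟨ length-++ Y₁ ⟩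
    length Y₁ + length Y₂  ≤⟨ +-mono-≤ (bound-L Y₁⊆ (AllPairs-resp-⊆ (++⁺ʳ Y₂ ⊆-refl) chain))
                                       (bound-M Y₂⊆ (AllPairs-resp-⊆ (++⁺ˡ Y₁ ⊆-refl) chain)) ⟩
    _                      ∎
    where open ≤-Reasoning

  chain-and-reversed⇒length≤1 : Asymmetric E → ∀ {Y} →
    AllPairs E Y → AllPairs (flip E) Y → length Y ≤ 1
  chain-and-reversed⇒length≤1 asym {[]}         _               _               = z≤n
  chain-and-reversed⇒length≤1 asym {_ ∷ []}     _               _               = s≤s z≤n
  chain-and-reversed⇒length≤1 asym {_ ∷ _ ∷ _} ((xEy ∷ _) ∷ _) ((yEx ∷ _) ∷ _) = ⊥-elim (asym xEy yEx)

  reversed-chainsAtMost-1 : Asymmetric E → ∀ {L} → AllPairs (flip E) L → ChainsAtMost E 1 L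
  reversed-chainsAtMost-1 asym reversed Y⊆ chain =
    chain-and-reversed⇒length≤1 asym chain (AllPairs-resp-⊆ Y⊆ reversed)

  module _ (E? : Decidable E) where

    chain-or-chainsAtMost : ∀ k L → Chain E (suc k) L ⊎ ChainsAtMost E k L
    chain-or-chainsAtMost k       []      = inj₂ λ { [] _ → z≤n }
    chain-or-chainsAtMost zero    (x ∷ L) = inj₁ ([ x ] , refl ∷ minimum L , [] ∷ [] , refl)
    chain-or-chainsAtMost (suc k) (x ∷ L)
      with chain-or-chainsAtMost k (filter (E? x) L) | chain-or-chainsAtMost (suc k) L
    ... | inj₁ (Y , Y⊆ , chain , len) | _ =
      inj₁ (x ∷ Y , refl ∷ ⊆-trans Y⊆ (filter-⊆ (E? x) L)
               , All-resp-⊆ Y⊆ (all-filter (E? x) L) ∷ chain , cong suc len)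
    ... | inj₂ _ | inj₁ (Y , Y⊆ , chain , len) = inj₁ (Y , x ∷ʳ Y⊆ , chain , len)
    ... | inj₂ bound-after-x | inj₂ bound-L = inj₂ bound
      where
      bound : ChainsAtMost E (suc k) (x ∷ L)
      bound (.x ∷ʳ Y⊆)  chain         = bound-L Y⊆ chain
      bound (refl ∷ Y⊆) (x→Y ∷ chain) = s≤s (bound-after-x Y⊆filter chain)
        where
        Y⊆filter : _ ⊆ filter (E? x) L
        Y⊆filter = subst (_⊆ filter (E? x) L) (filter-all (E? x) x→Y)
                     (Sublist.filter⁺ (E? x) (E? x) (λ { refl e → e }) Y⊆)

    ordering-with-short-chains : Asymmetric E → ∀ r S → 2 * length S < suc r * suc r →
      Σ (List A) λ L → L ↭ S × ChainsAtMost E r L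
    ordering-with-short-chains asym zero    []      _        = [] , ↭-refl , λ { [] _ → z≤n }
    ordering-with-short-chains asym zero    (_ ∷ _) (s≤s ())
    ordering-with-short-chains asym (suc r) S       small
      with chain-or-chainsAtMost (suc r) S
    ... | inj₂ bounded = S , ↭-refl , bounded
    ... | inj₁ (X , X⊆S , chain , len)
      with ⊆-complement X⊆S
    ... | C , S↭X++C
      with ordering-with-short-chains asym r C
             (2*[2+r+c]<[2+r]²⇒2*c<[1+r]² r (length C)
               (subst (λ n → 2 * n < (2 + r) * (2 + r))
                 (trans (↭-length S↭X++C) (trans (length-++ X) (cong (_+ length C) len))) small))
    ... | L , L↭C , bounded =
      reverse X ++ L , ↭-trans (++⁺ (↭-reverse X) L↭C) (↭-sym S↭X++C) ,
      chainsAtMost-++ (reversed-chainsAtMost-1 asym (AllPairs-reverse chain)) bounded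

module _ {t} {E : Fin t → Fin t → Set} where

  ordered-adjacent⇒edge : ∀ {π u w} → Before u w π → Adjacent (R E π) u w → E u w
  ordered-adjacent⇒edge _      (inj₁ (e , _))       = e
  ordered-adjacent⇒edge before (inj₂ (_ , before′)) = ⊥-elim (<-asym before before′)

  no-large-adjacent-set : ∀ {r} (π : LinearOrdering t) {L} → (∀ v → v ∈ L) →
    AllPairs (λ u w → Before u w π) L → ChainsAtMost E r L → ¬ PairwiseAdjacentSet (suc r) (R E π)
  no-large-adjacent-set π {L} complete ordered bounded (f , f-injective , adjacent) =
    1+n≰n (≤-trans (injective⇒≤ position-injective) (bounded (filter-⊆ InImage? L) image-chain))
    where
    InImage : Fin t → Set
    InImage v = ∃ λ a → f a ≡ v

    InImage? : ∀ v → Dec (InImage v)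
    InImage? v = any? λ a → f a ≟ v

    Image : List (Fin t)
    Image = filter InImage? L

    edge : ∀ {u w} → (InImage u × InImage w) × Before u w π → E u w
    edge (((a , refl) , (b , refl)) , before) =
      ordered-adjacent⇒edge {π} before (adjacent a b λ { refl → <-irrefl refl before })

    image-chain : AllPairs E Image
    image-chain = AllPairs.map edge
      (AllPairs.zip (All⇒AllPairs (all-filter InImage? L) , AllPairs.filter⁺ InImage? ordered))

    member : ∀ a → f a ∈ Image
    member a = ∈-filter⁺ InImage? (complete (f a)) (a , refl)

    position-injective : Injective _≡_ _≡_ (λ a → index (member a))
    position-injective {a} {b} = f-injective ∘ index-injective (setoid _) (member a) (member b)

  module _ (tournament : IsTournament E) where
    open IsTournament tournament

    tournament-decidable : Decidable E
    tournament-decidable i j with i ≟ j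
    ... | yes refl = no λ e → asymmetric i i e e
    ... | no i≢j with total i j i≢j
    ...   | inj₁ e  = yes e
    ...   | inj₂ e′ = no (asymmetric j i e′)

    vertex-list-with-short-chains :
      Σ (List (Fin t)) λ L → L ↭ allFin t × ChainsAtMost E ⌊√ (2 * t) ⌋ L
    vertex-list-with-short-chains =
      ordering-with-short-chains tournament-decidable (λ {i} {j} → asymmetric i j)
        ⌊√ (2 * t) ⌋ (allFin t)
        (subst (λ n → 2 * n < suc ⌊√ (2 * t) ⌋ * suc ⌊√ (2 * t) ⌋)
               (sym (length-tabulate {n = t} id)) (n<[1+⌊√n⌋]² (2 * t)))

↭-allFin⇒LinearOrdering : ∀ {t} {L : List (Fin t)} → L ↭ allFin t →
  Σ (LinearOrdering t) λ π → AllPairs (λ u w → Before u w π) L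
↭-allFin⇒LinearOrdering {t} {L} L↭allFin =
  enumeration unique complete length-L , enumeration-increasing unique complete length-L
  where
  unique : Unique L
  unique = Unique-resp-↭ (setoid _) (↭⇒↭ₛ (↭-sym L↭allFin)) (allFin⁺ t)

  complete : ∀ v → v ∈ L
  complete v = ∈-resp-↭ (↭-sym L↭allFin) (∈-allFin v)

  length-L : length L ≡ t
  length-L = trans (↭-length L↭allFin) (length-tabulate {n = t} id)

lemma2p1 : (t : ℕ) (E : Fin t → Fin t → Set) → IsTournament E →
    Σ (LinearOrdering t) λ π → ¬ PairwiseAdjacentSet (suc ⌊√ (2 * t) ⌋) (R E π)
lemma2p1 t E tournament with vertex-list-with-short-chains tournament
... | L , L↭allFin , bounded with ↭-allFin⇒LinearOrdering L↭allFin
... | π , ordered =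
  π , no-large-adjacent-set π (λ v → ∈-resp-↭ (↭-sym L↭allFin) (∈-allFin v)) ordered bounded
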